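{- Let $\Gamma$ be a presheaf on $\mathcal{C}\times\omega$ and $A$ a type over $\blacktriangleleft\Gamma$ in the presheaf model. If $A$ has a composition structure, then so does the type $\blacktriangleright_\Gamma A$ over $\Gamma$.
   Context: $\mathcal{C}$ is the category of cubes: objects are finite sets of names $I,J,\dots$, morphisms $J\to I$ are functions $I\to\mathsf{DM}(J)$ into the free De Morgan algebra on $J$, composed by Kleisli composition. $\omega$ is the poset of natural numbers as a category. Work in the presheaf category $\widehat{\mathcal{C}\times\omega}$ with its standard category-with-families structure: a type $A$ over $\Gamma$ is a family of sets $A(I,n,\gamma)$ for $\gamma\in\Gamma(I,n)$ with functorial restriction maps $A(I,n,\gamma)\to A(J,m,\gamma f)$ along $f:(J,m)\to(I,n)$, and a term of $A$ is a compatible family $t(I,n,\gamma)\in A(I,n,\gamma)$; substitution $A[\sigma]$ is reindexing. The interval $\mathbb{I}_\omega(I,n)=\mathsf{DM}(I)$; the face lattice $\mathbb{F}_\omega$ is the image of $r\mapsto(r=1):\mathbb{I}_\omega\to\Omega$ in the subobject classifier; for $\phi:\mathbb{F}_\omega$, $[\phi]=\{\star\mid\phi\}$. A composition structure on a type $A$ over $\Gamma$ is an operation taking (in the internal language) a path $\gamma : \mathbb{I}_\omega\to\Gamma$, a face $\phi:\mathbb{F}_\omega$, $u : [\phi]\to\Pi(i:\mathbb{I}_\omega).A[\gamma(i)]$ and $u_0 : A[\gamma(0)]$ with $\phi\to u\,\star\,0 = u_0$, and producing $c_A\,\gamma\,\phi\,u\,u_0 : A[\gamma(1)]$ with $\phi\to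 u\,\star\,1 = c_A\,\gamma\,\phi\,u\,u_0$. The functor $\blacktriangleleft$ on presheaves is $(\blacktriangleleft X)(I,n)=X(I,n+1)$. For a type $A$ over $\blacktriangleleft\Gamma$, the type $\blacktriangleright_\Gamma A$ over $\Gamma$ is $(\blacktriangleright_\Gamma A)(I,0,\gamma)=\{\star\}$ and $(\blacktriangleright_\Gamma A)(I,n+1,\gamma)=A(I,n,\gamma)$ (with $\gamma\in\Gamma(I,n+1)=(\blacktriangleleft\Gamma)(I,n)$). -}

module Defs where

open import Data.Bool using (Bool; true; false; not; _∧_; _∨_; if_then_else_; T)
open import Data.Bool.Properties using (T?)
open import Data.Nat using (ℕ; zero; suc; _+_; _≤_; s≤s; z≤n)
open import Data.Nat.Properties using (≤-refl; ≤-trans)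
open import Data.Fin using (Fin)
import Data.Fin as F
open import Data.Vec using (Vec; []; _∷_; map; tabulate; lookup; take; drop; _++_; tail)
open import Data.Product using (Σ; _,_; proj₁; proj₂; _×_)
open import Data.Unit using (⊤; tt)
import Data.Unit.Properties as UnitP
open import Relation.Nullary using (yes; no)
open import Relation.Binary.PropositionalEquality using (_≡_; refl; subst)
import Axiom.UniquenessOfIdentityProofs as UIPm

-- DM(J) is the free bounded distributive lattice on the 2J literals
-- i, ¬i (i : Fin J), represented canonically as the monotone Boolean
-- functions of 2J variables (full truth-table trees).  Assignments are
-- Vec Bool (J + J): first the J positive literals, then the J negative ones.

Fun : ℕ → Set
Fun zero    = Bool
Fun (suc k) = Fun k × Fun k

eval : ∀ {k} → Fun k → Vec Bool k → Bool
eval {zero}  b         []       = b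
eval {suc k} (f₀ , f₁) (x ∷ xs) = if x then eval f₁ xs else eval f₀ xs

tab : ∀ {k} → (Vec Bool k → Bool) → Fun k
tab {zero}  g = g []
tab {suc k} g = tab (λ xs → g (false ∷ xs)) , tab (λ xs → g (true ∷ xs))

leq : ∀ {k} → Fun k → Fun k → Bool
leq {zero}  a b = not a ∨ b
leq {suc k} (f₀ , f₁) (g₀ , g₁) = leq f₀ g₀ ∧ leq f₁ g₁

mono : ∀ {k} → Fun k → Bool
mono {zero}  _         = true
mono {suc k} (f₀ , f₁) = mono f₀ ∧ mono f₁ ∧ leq f₀ f₁

constF : ∀ k → Bool → Fun k
constF zero    b = b
constF (suc k) b = constF k b , constF k b

leq-refl : ∀ {k} (f : Fun k) → T (leq f f)
leq-refl {zero}  false = tt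
leq-refl {zero}  true  = tt
leq-refl {suc k} (f₀ , f₁) with leq f₀ f₀ | leq-refl f₀ | leq f₁ f₁ | leq-refl f₁
... | true | _ | true | _ = tt

constF-mono : ∀ k b → T (mono (constF k b))
constF-mono zero    b = tt
constF-mono (suc k) b with mono (constF k b) | constF-mono k b | leq (constF k b) (constF k b) | leq-refl (constF k b)
... | true | _ | true | _ = tt

record DM (J : ℕ) : Set where
  constructor dm
  field
    tbl : Fun (J + J)
    tbl-mono : T (mono tbl)

-- make an element of DM from a truth table that is monotone
-- (only ever applied to monotone tables; the fallback branch is never used)
mk : ∀ {J} → Fun (J + J) → DM J
mk {J} t with T? (mono t)
... | yes p = dm t p
... | no  _ = dm (constF (J + J) false) (constF-mono (J + J) false)

val : ∀ {J} → DM J → Vec Bool (J + J) → Bool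
val r ρ = eval (DM.tbl r) ρ

-- value of the De Morgan negation ¬r at ρ
nval : ∀ {J} → DM J → Vec Bool (J + J) → Bool
nval {J} r ρ = not (val r (map not (drop J ρ ++ take J ρ)))

zeroDM oneDM : ∀ {J} → DM J
zeroDM {J} = mk (constF (J + J) false)
oneDM  {J} = mk (constF (J + J) true)

var : ∀ {J} → Fin J → DM J
var {J} i = mk (tab (λ ρ → lookup ρ (i F.↑ˡ J)))

-- The cube category (skeleton: object I = set of names Fin I).
-- Hom J I = maps J → I = functions I → DM(J), as vectors.

Hom : ℕ → ℕ → Set
Hom J I = Vec (DM J) I

_[_] : ∀ {I J} → DM I → Hom J I → DM J
_[_] {I} {J} r f = mk (tab (λ ρ → val r (map (λ s → val s ρ) f ++ map (λ s → nval s ρ) f)))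

idH : ∀ I → Hom I I
idH I = tabulate var

_⊚_ : ∀ {I J K} → Hom J I → Hom K J → Hom K I
f ⊚ g = map (λ r → r [ g ]) f

-- the fresh name is name 0 of suc I
wk : ∀ J → Hom (suc J) J
wk J = tabulate (λ i → var (F.suc i))

lift : ∀ {I J} → Hom J I → Hom (suc J) (suc I)
lift {I} {J} g = var F.zero ∷ map (λ r → r [ wk J ]) g

e₀ e₁ : ∀ I → Hom I (suc I)
e₀ I = zeroDM ∷ idH I
e₁ I = oneDM ∷ idH I

record Psh : Set₁ where
  field
    Ob    : ℕ → ℕ → Set
    rs    : ∀ {I J n m} → Hom J I → m ≤ n → Ob I n → Ob J m
    rs-id : ∀ {I n} (x : Ob I n) → rs (idH I) ≤-refl x ≡ x
    rs-∘  : ∀ {I J K n m l} (f : Hom J I) (g : Hom K J) (p : m ≤ n) (q : l ≤ m) (x : Ob I n) →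
            rs (f ⊚ g) (≤-trans q p) x ≡ rs g q (rs f p x)
    Ob-set : ∀ {I n} {x y : Ob I n} (a b : x ≡ y) → a ≡ b

record Ty (Γ : Psh) : Set₁ where
  private module G = Psh Γ
  field
    Ob    : ∀ I n → G.Ob I n → Set
    rs    : ∀ {I J n m} (f : Hom J I) (p : m ≤ n) {γ : G.Ob I n} → Ob I n γ → Ob J m (G.rs f p γ)
    rs-id : ∀ {I n} {γ : G.Ob I n} (a : Ob I n γ) →
            subst (Ob I n) (G.rs-id γ) (rs (idH I) ≤-refl a) ≡ a
    rs-∘  : ∀ {I J K n m l} (f : Hom J I) (g : Hom K J) (p : m ≤ n) (q : l ≤ m) {γ : G.Ob I n} (a : Ob I n γ) →
            subst (Ob K l) (G.rs-∘ f g p q γ) (rs (f ⊚ g) (≤-trans q p) a) ≡ rs g q (rs f p a)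
    Ob-set : ∀ {I n} {γ : G.Ob I n} {x y : Ob I n γ} (a b : x ≡ y) → a ≡ b

◀ : Psh → Psh
◀ Γ = record
  { Ob = λ I n → Ob I (suc n)
  ; rs = λ f p → rs f (s≤s p)
  ; rs-id = rs-id
  ; rs-∘ = λ f g p q → rs-∘ f g (s≤s p) (s≤s q)
  ; Ob-set = Ob-set }
  where open Psh Γ

module _ (Γ : Psh) (A : Ty (◀ Γ)) where
  private
    module G = Psh Γ
    module A = Ty A

  ▶Ob : ∀ I n → G.Ob I n → Set
  ▶Ob I zero    γ = ⊤
  ▶Ob I (suc n) γ = A.Ob I n γ

  ▶rs : ∀ {I J n m} (f : Hom J I) (p : m ≤ n) {γ : G.Ob I n} → ▶Ob I n γ → ▶Ob J m (G.rs f p γ)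
  ▶rs {m = zero}  f p       a = tt
  ▶rs {m = suc m} f (s≤s p) a = A.rs f p a

  ▶rs-id : ∀ {I n} {γ : G.Ob I n} (a : ▶Ob I n γ) →
           subst (▶Ob I n) (G.rs-id γ) (▶rs {n = n} {m = n} (idH I) ≤-refl {γ} a) ≡ a
  ▶rs-id {n = zero}  a = refl
  ▶rs-id {I} {suc n} {γ} a = A.rs-id {I} {n} {γ} a

  ▶rs-∘ : ∀ {I J K n m l} (f : Hom J I) (g : Hom K J) (p : m ≤ n) (q : l ≤ m) {γ : G.Ob I n} (a : ▶Ob I n γ) →
          subst (▶Ob K l) (G.rs-∘ f g p q γ) (▶rs {n = n} {m = l} (f ⊚ g) (≤-trans q p) {γ} a)
            ≡ ▶rs {n = m} {m = l} g q (▶rs {n = n} {m = m} f p {γ} a)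
  ▶rs-∘ {l = zero}  f g p q a = refl
  ▶rs-∘ {l = suc l} f g (s≤s p) (s≤s q) {γ} a = A.rs-∘ f g p q {γ} a

  ▶Ob-set : ∀ {I n} {γ : G.Ob I n} {x y : ▶Ob I n γ} (a b : x ≡ y) → a ≡ b
  ▶Ob-set {n = zero}  a b = UIPm.Decidable⇒UIP.≡-irrelevant UnitP._≟_ a b
  ▶Ob-set {I} {suc n} {γ} a b = A.Ob-set {I} {n} {γ} a b

  ▶ : Ty Γ
  ▶ = record { Ob = ▶Ob ; rs = ▶rs ; rs-id = ▶rs-id ; rs-∘ = ▶rs-∘ ; Ob-set = λ {I} {n} {γ} → ▶Ob-set {I} {n} {γ} }

-- A path γ : 𝕀 → Γ at stage (I,n) is an element of
-- Γ(suc I, n); a face φ at stage (I,n) is given by a representative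
-- r : DM I of φ = (r = 1) (faces are the image of DM I in Ω, i.e. the
-- sieves {f | r[f] = 1}); uniformity below quantifies over every
-- representative of the restricted face, so the operation only depends
-- on the face.

IsOne : ∀ {J} → DM J → Set
IsOne r = r ≡ oneDM

module CompDefs (Γ : Psh) (A : Ty Γ) where
  private
    module G = Psh Γ
    module A = Ty A

  γ₀ γ₁ : ∀ {I n} → G.Ob (suc I) n → G.Ob I n
  γ₀ {I} γ = G.rs (e₀ I) ≤-refl γ
  γ₁ {I} γ = G.rs (e₁ I) ≤-refl γ

  -- u : [φ] → Π(i : 𝕀). A[γ i]   at stage (I , n)
  record Partial {I n} (γ : G.Ob (suc I) n) (r : DM I) : Set where
    field
      pval : ∀ {J m} (h : Hom J (suc I)) (p : m ≤ n) → IsOne (r [ tail h ]) → A.Ob J m (G.rs h p γ)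
      pval-nat : ∀ {J m K l} (h : Hom J (suc I)) (g : Hom K J) (p : m ≤ n) (q : l ≤ m)
                 (e : IsOne (r [ tail h ])) (e' : IsOne (r [ tail (h ⊚ g) ])) →
                 subst (A.Ob K l) (G.rs-∘ h g p q γ) (pval (h ⊚ g) (≤-trans q p) e') ≡ A.rs g q (pval h p e)
  open Partial public

  -- φ → u ⋆ 0 = u₀
  Agree₀ : ∀ {I n} {γ : G.Ob (suc I) n} {r : DM I} → Partial γ r → A.Ob I n (γ₀ γ) → Set
  Agree₀ {I} {n} {γ} {r} u u₀ =
    ∀ {J m} (f : Hom J I) (p : m ≤ n) (e : IsOne (r [ f ]))
      (eq : G.rs (zeroDM ∷ f) p γ ≡ G.rs f p (γ₀ γ)) →
      subst (A.Ob J m) eq (pval u (zeroDM ∷ f) p e) ≡ A.rs f p u₀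

  record CompStr : Set where
    field
      comp : ∀ {I n} (γ : G.Ob (suc I) n) (r : DM I) (u : Partial γ r) (u₀ : A.Ob I n (γ₀ γ)) →
             Agree₀ u u₀ → A.Ob I n (γ₁ γ)
      -- φ → u ⋆ 1 = comp γ φ u u₀
      comp-face : ∀ {I n} (γ : G.Ob (suc I) n) (r : DM I) (u : Partial γ r) (u₀ : A.Ob I n (γ₀ γ))
                  (a : Agree₀ u u₀) {J m} (f : Hom J I) (p : m ≤ n) (e : IsOne (r [ f ]))
                  (eq : G.rs (oneDM ∷ f) p γ ≡ G.rs f p (γ₁ γ)) →
                  subst (A.Ob J m) eq (pval u (oneDM ∷ f) p e) ≡ A.rs f p (comp γ r u u₀ a)
      -- naturality in the stage (the operation is a global element)
      comp-unif : ∀ {I n J m} (γ : G.Ob (suc I) n) (r : DM I) (u : Partial γ r) (u₀ : A.Ob I n (γ₀ γ))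
                  (a : Agree₀ u u₀) (g : Hom J I) (q : m ≤ n)
                  (r' : DM J) (sieve : ∀ {K} (h : Hom K J) → (IsOne (r' [ h ]) → IsOne (r [ g ⊚ h ])) ×
                                                              (IsOne (r [ g ⊚ h ]) → IsOne (r' [ h ])))
                  (u' : Partial (G.rs (lift g) q γ) r')
                  (u'-restr : ∀ {K l} (h : Hom K (suc J)) (p : l ≤ m) (e : IsOne (r' [ tail h ]))
                              (e' : IsOne (r [ tail (lift g ⊚ h) ])) →
                              subst (A.Ob K l) (G.rs-∘ (lift g) h q p γ) (pval u (lift g ⊚ h) (≤-trans p q) e')
                                ≡ pval u' h p e)
                  (u₀' : A.Ob J m (γ₀ (G.rs (lift g) q γ)))
                  (u₀'-restr : (eq : G.rs g q (γ₀ γ) ≡ γ₀ (G.rs (lift g) q γ)) →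
                               subst (A.Ob J m) eq (A.rs g q u₀) ≡ u₀')
                  (a' : Agree₀ u' u₀')
                  (eq : G.rs g q (γ₁ γ) ≡ γ₁ (G.rs (lift g) q γ)) →
                  subst (A.Ob J m) eq (A.rs g q (comp γ r u u₀ a)) ≡ comp (G.rs (lift g) q γ) r' u' u₀' a'

HasComp : (Γ : Psh) → Ty Γ → Set
HasComp Γ A = CompDefs.CompStr Γ A

module Submission where

open import Defs
open import Data.Nat using (zero; suc; _≤_; s≤s)
open import Data.Nat.Properties using (≤-trans)
open import Data.Product using (_×_)
open import Data.Unit using (tt)
open import Data.Vec using (_∷_; tail)
open import Relation.Binary.PropositionalEquality using (_≡_; refl; subst)

-- At level 0 the type ▶A is the singleton, so composition there is forced and
-- every face and uniformity condition holds by η for ⊤.  At level n + 1 it is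
-- A at level n, and a partial element of ▶A at stage (I , n + 1) only has
-- non-trivial values at levels m + 1 ≤ n + 1, i.e. it is literally a partial
-- element of A at stage (I , n); so A's composition, with its face and
-- uniformity conditions, applies verbatim.

module ▶-Comp (Γ : Psh) (A : Ty (◀ Γ)) (cA : HasComp (◀ Γ) A) where
  private
    module Γ = Psh Γ
    module A = CompDefs (◀ Γ) A
    module ▶A where
      open Ty (▶ Γ A) public
      open CompDefs Γ (▶ Γ A) public
  open A.CompStr cA

  partial-pred : ∀ {I n} {γ : Γ.Ob (suc I) (suc n)} {r : DM I} →
                 ▶A.Partial {I} {suc n} γ r → A.Partial {I} {n} γ r
  partial-pred u = record
    { pval     = λ h p → ▶A.pval u h (s≤s p)
    ; pval-nat = λ h g p q → ▶A.pval-nat u h g (s≤s p) (s≤s q)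
    }

  agree₀-pred : ∀ {I n} {γ : Γ.Ob (suc I) (suc n)} {r : DM I}
                (u : ▶A.Partial {I} {suc n} γ r) (u₀ : ▶A.Ob I (suc n) (▶A.γ₀ γ)) →
                ▶A.Agree₀ u u₀ → A.Agree₀ (partial-pred u) u₀
  agree₀-pred u u₀ a f p = a f (s≤s p)

  ▶-comp : ∀ {I n} (γ : Γ.Ob (suc I) n) (r : DM I) (u : ▶A.Partial γ r) (u₀ : ▶A.Ob I n (▶A.γ₀ γ)) →
           ▶A.Agree₀ u u₀ → ▶A.Ob I n (▶A.γ₁ γ)
  ▶-comp {n = zero}  γ r u u₀ a = tt
  ▶-comp {n = suc n} γ r u u₀ a = comp γ r (partial-pred u) u₀ (agree₀-pred u u₀ a)

  ▶-comp-face : ∀ {I n} (γ : Γ.Ob (suc I) n) (r : DM I) (u : ▶A.Partial γ r) (u₀ : ▶A.Ob I n (▶A.γ₀ γ))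
                (a : ▶A.Agree₀ u u₀) {J m} (f : Hom J I) (p : m ≤ n) (e : IsOne (r [ f ]))
                (eq : Γ.rs (oneDM ∷ f) p γ ≡ Γ.rs f p (▶A.γ₁ γ)) →
                subst (▶A.Ob J m) eq (▶A.pval u (oneDM ∷ f) p e) ≡ ▶A.rs f p (▶-comp γ r u u₀ a)
  ▶-comp-face γ r u u₀ a {m = zero} f p e eq = refl
  ▶-comp-face γ r u u₀ a {m = suc m} f (s≤s p) e eq =
    comp-face γ r (partial-pred u) u₀ (agree₀-pred u u₀ a) f p e eq

  ▶-comp-unif : ∀ {I n J m} (γ : Γ.Ob (suc I) n) (r : DM I) (u : ▶A.Partial γ r) (u₀ : ▶A.Ob I n (▶A.γ₀ γ))
                (a : ▶A.Agree₀ u u₀) (g : Hom J I) (q : m ≤ n)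
                (r' : DM J) (sieve : ∀ {K} (h : Hom K J) → (IsOne (r' [ h ]) → IsOne (r [ g ⊚ h ])) ×
                                                            (IsOne (r [ g ⊚ h ]) → IsOne (r' [ h ])))
                (u' : ▶A.Partial (Γ.rs (lift g) q γ) r')
                (u'-restr : ∀ {K l} (h : Hom K (suc J)) (p : l ≤ m) (e : IsOne (r' [ tail h ]))
                            (e' : IsOne (r [ tail (lift g ⊚ h) ])) →
                            subst (▶A.Ob K l) (Γ.rs-∘ (lift g) h q p γ) (▶A.pval u (lift g ⊚ h) (≤-trans p q) e')
                              ≡ ▶A.pval u' h p e)
                (u₀' : ▶A.Ob J m (▶A.γ₀ (Γ.rs (lift g) q γ)))
                (u₀'-restr : (eq : Γ.rs g q (▶A.γ₀ γ) ≡ ▶A.γ₀ (Γ.rs (lift g) q γ)) →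
                             subst (▶A.Ob J m) eq (▶A.rs g q u₀) ≡ u₀')
                (a' : ▶A.Agree₀ u' u₀')
                (eq : Γ.rs g q (▶A.γ₁ γ) ≡ ▶A.γ₁ (Γ.rs (lift g) q γ)) →
                subst (▶A.Ob J m) eq (▶A.rs g q (▶-comp γ r u u₀ a)) ≡ ▶-comp (Γ.rs (lift g) q γ) r' u' u₀' a'
  ▶-comp-unif {m = zero} γ r u u₀ a g q r' sieve u' u'-restr u₀' u₀'-restr a' eq = refl
  ▶-comp-unif {m = suc m} γ r u u₀ a g (s≤s q) r' sieve u' u'-restr u₀' u₀'-restr a' eq =
    comp-unif γ r (partial-pred u) u₀ (agree₀-pred u u₀ a) g q r' sieve (partial-pred u')
      (λ h p → u'-restr h (s≤s p)) u₀' u₀'-restr (agree₀-pred u' u₀' a') eq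

  ▶-compStr : HasComp Γ (▶ Γ A)
  ▶-compStr = record
    { comp      = ▶-comp
    ; comp-face = ▶-comp-face
    ; comp-unif = ▶-comp-unif
    }

lemma8p5 : (Γ : Psh) (A : Ty (◀ Γ)) → HasComp (◀ Γ) A → HasComp Γ (▶ Γ A)
lemma8p5 = ▶-Comp.▶-compStr
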